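{- Let $A$ be an AL-monoid. Lattice betweenness and metric betweenness are equivalent in $A$ (i.e. for all $a,b,c\in A$, $(a,b,c)L$ holds iff $(a,b,c)M$ holds) if and only if metric betweenness has transitivity $t_1$ (i.e. for all $a,b,c,d\in A$, $(a,b,c)M$ and $(a,d,b)M$ imply $(d,b,c)M$).
   Context: An AL-monoid (autometrized lattice ordered monoid) is an algebra $(A,+,\vee,\wedge,\ast,0)$ of type $(2,2,2,2,0)$ such that: (1) $(A,+,\vee,\wedge,0)$ is a commutative lattice ordered monoid, i.e. $(A,+,0)$ is a commutative monoid with identity $0$, $(A,\vee,\wedge)$ is a lattice with induced order $\leq$, and $a+(b\vee c)=(a+b)\vee(a+c)$, $a+(b\wedge c)=(a+b)\wedge(a+c)$; (2) $a\ast(a\wedge b)+b=a\vee b$ for all $a,b$; (3) for each $a\in A$ the maps $x\mapsto a+x$, $x\mapsto a\vee x$, $x\mapsto a\wedge x$, $x\mapsto a\ast x$ are contractions with respect to $\ast$, i.e. $f(x)\ast f(y)\leq x\ast y$ for all $x,y$; (4) $[a\ast(a\vee b)]\wedge[b\ast(a\vee b)]=0$ for all $a,b$; and $\ast$ is a metric operation: $a\ast b\geq 0$ with equality iff $a=b$, $a\ast b=b\ast a$, and $a\ast b\leq a\ast c+c\ast b$ for all $a,b,c$. Lattice betweenness $(a,b,c)L$ means $a\wedge c\leq b\leq a\vee c$; metric betweenness $(a,b,c)M$ means $a\ast b+b\ast c=a\ast c$. -}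

module Defs where

open import Level using (Level; suc)
open import Relation.Binary.PropositionalEquality using (_≡_)
open import Data.Product using (_×_)
open import Function.Bundles using (_⇔_)

record ALMonoid (a : Level) : Set (suc a) where
  infixl 6 _+_
  infixl 7 _∨_ _∧_
  infixl 8 _*_
  infix 4 _≤_
  field
    A   : Set a
    _+_ : A → A → A
    _∨_ : A → A → A
    _∧_ : A → A → A
    _*_ : A → A → A
    𝟘   : A

  _≤_ : A → A → Set a
  x ≤ y = x ∨ y ≡ y

  field
    +-assoc    : ∀ x y z → (x + y) + z ≡ x + (y + z)
    +-comm     : ∀ x y → x + y ≡ y + x
    +-identity : ∀ x → 𝟘 + x ≡ x
    ∨-comm     : ∀ x y → x ∨ y ≡ y ∨ x
    ∧-comm     : ∀ x y → x ∧ y ≡ y ∧ x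
    ∨-assoc    : ∀ x y z → (x ∨ y) ∨ z ≡ x ∨ (y ∨ z)
    ∧-assoc    : ∀ x y z → (x ∧ y) ∧ z ≡ x ∧ (y ∧ z)
    ∨-absorbs-∧ : ∀ x y → x ∨ (x ∧ y) ≡ x
    ∧-absorbs-∨ : ∀ x y → x ∧ (x ∨ y) ≡ x
    +-distrib-∨ : ∀ x y z → x + (y ∨ z) ≡ (x + y) ∨ (x + z)
    +-distrib-∧ : ∀ x y z → x + (y ∧ z) ≡ (x + y) ∧ (x + z)
    ax2 : ∀ x y → x * (x ∧ y) + y ≡ x ∨ y
    +-contr : ∀ c x y → (c + x) * (c + y) ≤ x * y
    ∨-contr : ∀ c x y → (c ∨ x) * (c ∨ y) ≤ x * y
    ∧-contr : ∀ c x y → (c ∧ x) * (c ∧ y) ≤ x * y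
    *-contr : ∀ c x y → (c * x) * (c * y) ≤ x * y
    ax4 : ∀ x y → (x * (x ∨ y)) ∧ (y * (x ∨ y)) ≡ 𝟘
    *-nonneg : ∀ x y → 𝟘 ≤ x * y
    *-zero⇔  : ∀ x y → (x * y ≡ 𝟘) ⇔ (x ≡ y)
    *-comm   : ∀ x y → x * y ≡ y * x
    *-triangle : ∀ x y z → x * y ≤ x * z + z * y

  BetweenL : A → A → A → Set a
  BetweenL x y z = (x ∧ z ≤ y) × (y ≤ x ∨ z)

  BetweenM : A → A → A → Set a
  BetweenM x y z = x * y + y * z ≡ x * z

  BetweennessEquivalent : Set a
  BetweennessEquivalent = ∀ x y z → BetweenL x y z ⇔ BetweenM x y z

  TransitivityT1 : Set a
  TransitivityT1 = ∀ x y z w → BetweenM x y z → BetweenM x w y → BetweenM w y z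

-- Every AL-monoid is a cancellative lattice, since y = (x ∨ y) * x + (x ∧ y) recovers y from
-- x ∧ y and x ∨ y; cancellation gives modularity and then, collapsing the diamond that a
-- modular lattice builds over the medians of any three elements, distributivity. In a
-- distributive lattice, lattice betweenness satisfies t₁, and together with the identities
-- x * y = x * (x ∨ y) + (x ∨ y) * y = x * (x ∧ y) + (x ∧ y) * y it implies metric betweenness.
-- Conversely, under t₁ a metric betweenness (a, b, c)M moves to the endpoints a ∨ b, c ∨ b
-- (resp. a ∧ b, c ∧ b), and t₁ applied once more pins b to their meet (resp. join), whence
-- a ∧ c ≤ b ≤ a ∨ c.
module Submission where

open import Defs
open import Level using (Level; _⊔_)
open import Function.Bundles using (_⇔_; mk⇔; Equivalence)
open import Data.Product using (_,_)
open import Relation.Binary.Structures using (IsPartialOrder)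
open import Relation.Binary.Lattice
  using (Lattice; IsDistributiveLattice; DistributiveLattice; Supremum; Infimum)
import Relation.Binary.Reasoning.PartialOrder as ≤-Reasoning

Modular : ∀ {c ℓ₁ ℓ₂} → Lattice c ℓ₁ ℓ₂ → Set (c ⊔ ℓ₂)
Modular L = ∀ {x y z} → x ≤ z → (x ∨ y) ∧ z ≤ x ∨ (y ∧ z)
  where open Lattice L

Cancellative : ∀ {c ℓ₁ ℓ₂} → Lattice c ℓ₁ ℓ₂ → Set (c ⊔ ℓ₁)
Cancellative L = ∀ x y z → x ∧ y ≈ x ∧ z → x ∨ y ≈ x ∨ z → y ≈ z
  where open Lattice L

module ModularLatticeProperties {c ℓ₁ ℓ₂} (L : Lattice c ℓ₁ ℓ₂) (modular : Modular L) where
  open Lattice L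
  open import Relation.Binary.Lattice.Properties.JoinSemilattice joinSemilattice
    using (∨-monotonic; ∨-comm)
  open import Relation.Binary.Lattice.Properties.MeetSemilattice meetSemilattice
    using (∧-monotonic; ∧-comm)
  open ≤-Reasoning poset

  module _ {a b c d e : Carrier} where
    diamond-∧ : a ∧ b ≤ d → c ∧ a ≤ d → d ≤ b ∨ (c ∧ a) →
                ((a ∧ e) ∨ d) ∧ ((b ∧ e) ∨ d) ≈ d
    diamond-∧ ab≤d ca≤d d≤b∨ca = antisym
      (begin
        ((a ∧ e) ∨ d) ∧ ((b ∧ e) ∨ d)  ≤⟨ ∧-monotonic (reflexive (∨-comm _ _)) refl ⟩
        (d ∨ (a ∧ e)) ∧ ((b ∧ e) ∨ d)  ≤⟨ modular (y≤x∨y _ _) ⟩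
        d ∨ ((a ∧ e) ∧ ((b ∧ e) ∨ d))  ≤⟨ ∨-least refl ae∧be∨d≤d ⟩
        d                              ∎)
      (∧-greatest (y≤x∨y _ _) (y≤x∨y _ _))
      where
      ae∧be∨d≤d : (a ∧ e) ∧ ((b ∧ e) ∨ d) ≤ d
      ae∧be∨d≤d = begin
        (a ∧ e) ∧ ((b ∧ e) ∨ d)  ≤⟨ ∧-greatest (x∧y≤y _ _) (trans (x∧y≤x _ _) (x∧y≤x _ _)) ⟩
        ((b ∧ e) ∨ d) ∧ a        ≤⟨ ∧-monotonic (∨-least (trans (x∧y≤x _ _) (x≤x∨y _ _)) d≤b∨ca) refl ⟩
        (b ∨ (c ∧ a)) ∧ a        ≤⟨ ∧-monotonic (reflexive (∨-comm _ _)) refl ⟩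
        ((c ∧ a) ∨ b) ∧ a        ≤⟨ modular (x∧y≤y _ _) ⟩
        (c ∧ a) ∨ (b ∧ a)        ≤⟨ ∨-least ca≤d (trans (reflexive (∧-comm _ _)) ab≤d) ⟩
        d                        ∎

    diamond-∨ : d ≤ e → e ≤ a ∨ b → e ≤ a ∨ c → b ∧ (a ∨ c) ≤ e →
                ((a ∧ e) ∨ d) ∨ ((b ∧ e) ∨ d) ≈ e
    diamond-∨ d≤e e≤a∨b e≤a∨c b∧[a∨c]≤e = antisym
      (∨-least (∨-least (x∧y≤y _ _) d≤e) (∨-least (x∧y≤y _ _) d≤e))
      (begin
        e                              ≤⟨ ∧-greatest e≤a∨be refl ⟩
        (a ∨ (b ∧ e)) ∧ e              ≤⟨ ∧-monotonic (reflexive (∨-comm _ _)) refl ⟩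
        ((b ∧ e) ∨ a) ∧ e              ≤⟨ modular (x∧y≤y _ _) ⟩
        (b ∧ e) ∨ (a ∧ e)              ≤⟨ ∨-least (trans (x≤x∨y _ _) (y≤x∨y _ _))
                                                  (trans (x≤x∨y _ _) (x≤x∨y _ _)) ⟩
        ((a ∧ e) ∨ d) ∨ ((b ∧ e) ∨ d)  ∎)
      where
      e≤a∨be : e ≤ a ∨ (b ∧ e)
      e≤a∨be = begin
        e                  ≤⟨ ∧-greatest e≤a∨b e≤a∨c ⟩
        (a ∨ b) ∧ (a ∨ c)  ≤⟨ modular (x≤x∨y _ _) ⟩
        a ∨ (b ∧ (a ∨ c))  ≤⟨ ∨-monotonic refl (∧-greatest (x∧y≤x _ _) b∧[a∨c]≤e) ⟩
        a ∨ (b ∧ e)        ∎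

  lowerMedian upperMedian : Carrier → Carrier → Carrier → Carrier
  lowerMedian a b c = (a ∧ b) ∨ (b ∧ c) ∨ (c ∧ a)
  upperMedian a b c = (a ∨ b) ∧ (b ∨ c) ∧ (c ∨ a)

  private
    x∧y≤x∨z : ∀ {x y z} → x ∧ y ≤ x ∨ z
    x∧y≤x∨z = trans (x∧y≤x _ _) (x≤x∨y _ _)
    x∧y≤z∨x : ∀ {x y z} → x ∧ y ≤ z ∨ x
    x∧y≤z∨x = trans (x∧y≤x _ _) (y≤x∨y _ _)
    x∧y≤y∨z : ∀ {x y z} → x ∧ y ≤ y ∨ z
    x∧y≤y∨z = trans (x∧y≤y _ _) (x≤x∨y _ _)
    ∧-swap : ∀ {x y} → x ∧ y ≤ y ∧ x
    ∧-swap = reflexive (∧-comm _ _)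
    ∨-swap : ∀ {x y} → x ∨ y ≤ y ∨ x
    ∨-swap = reflexive (∨-comm _ _)

  -- The elements (x ∧ upper) ∨ lower for x = a, b, c pairwise meet in the lower and join in
  -- the upper median: a diamond, collapsing to a point exactly when the medians agree.
  module MedianDiamond (a b c : Carrier) where
    lower upper a′ b′ c′ : Carrier
    lower = lowerMedian a b c
    upper = upperMedian a b c
    a′ = (a ∧ upper) ∨ lower
    b′ = (b ∧ upper) ∨ lower
    c′ = (c ∧ upper) ∨ lower

    private
      lower≤ : ∀ {t} → a ∧ b ≤ t → b ∧ c ≤ t → c ∧ a ≤ t → lower ≤ t
      lower≤ ab≤t bc≤t ca≤t = ∨-least ab≤t (∨-least bc≤t ca≤t)
      ≤upper : ∀ {t} → t ≤ a ∨ b → t ≤ b ∨ c → t ≤ c ∨ a → t ≤ upper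
      ≤upper t≤ab t≤bc t≤ca = ∧-greatest t≤ab (∧-greatest t≤bc t≤ca)

      ab≤lower : a ∧ b ≤ lower
      ab≤lower = x≤x∨y _ _
      bc≤lower : b ∧ c ≤ lower
      bc≤lower = trans (x≤x∨y _ _) (y≤x∨y _ _)
      ca≤lower : c ∧ a ≤ lower
      ca≤lower = trans (y≤x∨y _ _) (y≤x∨y _ _)
      upper≤ab : upper ≤ a ∨ b
      upper≤ab = x∧y≤x _ _
      upper≤bc : upper ≤ b ∨ c
      upper≤bc = trans (x∧y≤y _ _) (x∧y≤x _ _)
      upper≤ca : upper ≤ c ∨ a
      upper≤ca = trans (x∧y≤y _ _) (x∧y≤y _ _)
      lower≤upper : lower ≤ upper
      lower≤upper = lower≤ (≤upper x∧y≤x∨z x∧y≤y∨z x∧y≤z∨x)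
                           (≤upper x∧y≤z∨x x∧y≤x∨z x∧y≤y∨z)
                           (≤upper x∧y≤y∨z x∧y≤z∨x x∧y≤x∨z)

    a′∧b′≈lower : a′ ∧ b′ ≈ lower
    a′∧b′≈lower = diamond-∧ ab≤lower ca≤lower (lower≤ x∧y≤y∨z x∧y≤x∨z (y≤x∨y _ _))

    a′∨b′≈upper : a′ ∨ b′ ≈ upper
    a′∨b′≈upper = diamond-∨ lower≤upper upper≤ab (trans upper≤ca ∨-swap)
      (≤upper x∧y≤z∨x x∧y≤x∨z (trans (x∧y≤y _ _) ∨-swap))

    a′∧c′≈lower : a′ ∧ c′ ≈ lower
    a′∧c′≈lower = diamond-∧ (trans ∧-swap ca≤lower) (trans ∧-swap ab≤lower)
      (lower≤ (trans ∧-swap (y≤x∨y _ _)) x∧y≤y∨z x∧y≤x∨z)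

    a′∨c′≈upper : a′ ∨ c′ ≈ upper
    a′∨c′≈upper = diamond-∨ lower≤upper (trans upper≤ca ∨-swap) upper≤ab
      (≤upper (x∧y≤y _ _) x∧y≤z∨x x∧y≤x∨z)

    b′∧c′≈lower : b′ ∧ c′ ≈ lower
    b′∧c′≈lower = diamond-∧ bc≤lower ab≤lower (lower≤ (y≤x∨y _ _) x∧y≤y∨z x∧y≤x∨z)

    b′∨c′≈upper : b′ ∨ c′ ≈ upper
    b′∨c′≈upper = diamond-∨ lower≤upper upper≤bc (trans upper≤ab ∨-swap)
      (≤upper (trans (x∧y≤y _ _) ∨-swap) x∧y≤z∨x x∧y≤x∨z)

module CancellativeLatticeProperties {c ℓ₁ ℓ₂} (L : Lattice c ℓ₁ ℓ₂) (cancel : Cancellative L) where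
  open Lattice L
  open import Relation.Binary.Lattice.Properties.JoinSemilattice joinSemilattice
    using (∨-monotonic; ∨-cong; ∨-idempotent)
  open import Relation.Binary.Lattice.Properties.MeetSemilattice meetSemilattice
    using (∧-monotonic; ∧-comm; ∧-cong; ∧-idempotent)
  open ≤-Reasoning poset

  modular : Modular L
  modular {x} {y} {z} x≤z = reflexive (cancel y q p y∧q≈y∧p y∨q≈y∨p)
    where
    p q : Carrier
    p = x ∨ (y ∧ z)
    q = (x ∨ y) ∧ z
    p≤q : p ≤ q
    p≤q = ∨-least (∧-greatest (x≤x∨y _ _) x≤z) (∧-monotonic (y≤x∨y _ _) refl)
    y∧q≈y∧p : y ∧ q ≈ y ∧ p
    y∧q≈y∧p = antisym
      (∧-greatest (x∧y≤x _ _) (trans (∧-monotonic refl (x∧y≤y _ _)) (y≤x∨y _ _)))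
      (∧-monotonic refl p≤q)
    y∨q≈y∨p : y ∨ q ≈ y ∨ p
    y∨q≈y∨p = antisym
      (∨-least (x≤x∨y _ _) (trans (x∧y≤x _ _) (∨-least (trans (x≤x∨y _ _) (y≤x∨y _ _)) (x≤x∨y _ _))))
      (∨-monotonic refl p≤q)

  open ModularLatticeProperties L modular using (lowerMedian; upperMedian; module MedianDiamond)

  lowerMedian≈upperMedian : ∀ a b c → lowerMedian a b c ≈ upperMedian a b c
  lowerMedian≈upperMedian a b c = begin-equality
    lower    ≈⟨ b′∧c′≈lower ⟨
    b′ ∧ c′  ≈⟨ ∧-cong Eq.refl (Eq.sym b′≈c′) ⟩
    b′ ∧ b′  ≈⟨ ∧-idempotent b′ ⟩
    b′       ≈⟨ ∨-idempotent b′ ⟨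
    b′ ∨ b′  ≈⟨ ∨-cong Eq.refl b′≈c′ ⟩
    b′ ∨ c′  ≈⟨ b′∨c′≈upper ⟩
    upper    ∎
    where
    open MedianDiamond a b c
    b′≈c′ : b′ ≈ c′
    b′≈c′ = cancel a′ b′ c′ (Eq.trans a′∧b′≈lower (Eq.sym a′∧c′≈lower))
                            (Eq.trans a′∨b′≈upper (Eq.sym a′∨c′≈upper))

  ∧-distribˡ-∨ : ∀ x y z → x ∧ (y ∨ z) ≈ (x ∧ y) ∨ (x ∧ z)
  ∧-distribˡ-∨ x y z = antisym
    (begin
      x ∧ (y ∨ z)                            ≤⟨ ∧-greatest (x∧y≤x _ _) x∧[y∨z]≤upper ⟩
      x ∧ upperMedian x y z                  ≈⟨ ∧-cong Eq.refl (lowerMedian≈upperMedian x y z) ⟨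
      x ∧ ((x ∧ y) ∨ (y ∧ z) ∨ (z ∧ x))      ≤⟨ reflexive (∧-comm _ _) ⟩
      ((x ∧ y) ∨ (y ∧ z) ∨ (z ∧ x)) ∧ x      ≤⟨ modular (x∧y≤x _ _) ⟩
      (x ∧ y) ∨ (((y ∧ z) ∨ (z ∧ x)) ∧ x)    ≤⟨ ∨-monotonic refl [[y∧z]∨[z∧x]]∧x≤x∧z ⟩
      (x ∧ y) ∨ (x ∧ z)                      ∎)
    (∨-least (∧-monotonic refl (x≤x∨y _ _)) (∧-monotonic refl (y≤x∨y _ _)))
    where
    [[y∧z]∨[z∧x]]∧x≤x∧z : ((y ∧ z) ∨ (z ∧ x)) ∧ x ≤ x ∧ z
    [[y∧z]∨[z∧x]]∧x≤x∧z =
      ∧-greatest (x∧y≤y _ _) (trans (x∧y≤x _ _) (∨-least (x∧y≤y _ _) (x∧y≤x _ _)))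
    x∧[y∨z]≤upper : x ∧ (y ∨ z) ≤ upperMedian x y z
    x∧[y∨z]≤upper = ∧-greatest (trans (x∧y≤x _ _) (x≤x∨y _ _))
      (∧-greatest (x∧y≤y _ _) (trans (x∧y≤x _ _) (y≤x∨y _ _)))

  isDistributiveLattice : IsDistributiveLattice _≈_ _≤_ _∨_ _∧_
  isDistributiveLattice = record { isLattice = isLattice ; ∧-distribˡ-∨ = ∧-distribˡ-∨ }

  distributiveLattice : DistributiveLattice c ℓ₁ ℓ₂
  distributiveLattice = record { isDistributiveLattice = isDistributiveLattice }

module ALMonoidProperties {ℓ : Level} (M : ALMonoid ℓ) where
  open ALMonoid M
  open import Relation.Binary.PropositionalEquality
    using (_≡_; refl; sym; trans; cong; cong₂; subst; subst₂; isEquivalence; module ≡-Reasoning)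

  ∨-idem : ∀ x → x ∨ x ≡ x
  ∨-idem x = trans (cong (x ∨_) (sym (∧-absorbs-∨ x x))) (∨-absorbs-∧ x (x ∨ x))

  ∧-idem : ∀ x → x ∧ x ≡ x
  ∧-idem x = trans (cong (x ∧_) (sym (∨-absorbs-∧ x x))) (∧-absorbs-∨ x (x ∧ x))

  ≤-isPartialOrder : IsPartialOrder _≡_ _≤_
  ≤-isPartialOrder = record
    { isPreorder = record
      { isEquivalence = isEquivalence
      ; reflexive = λ { refl → ∨-idem _ }
      ; trans = λ {x} {y} {z} x≤y y≤z → begin
          x ∨ z        ≡⟨ cong (x ∨_) y≤z ⟨
          x ∨ (y ∨ z)  ≡⟨ ∨-assoc x y z ⟨
          (x ∨ y) ∨ z  ≡⟨ cong (_∨ z) x≤y ⟩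
          y ∨ z        ≡⟨ y≤z ⟩
          z            ∎
      }
    ; antisym = λ {x} {y} x≤y y≤x → trans (sym y≤x) (trans (∨-comm y x) x≤y)
    }
    where open ≡-Reasoning

  ∧⇒≤ : ∀ {x y} → x ∧ y ≡ x → x ≤ y
  ∧⇒≤ {x} {y} x∧y≡x = begin
    x ∨ y        ≡⟨ cong (_∨ y) x∧y≡x ⟨
    (x ∧ y) ∨ y  ≡⟨ ∨-comm (x ∧ y) y ⟩
    y ∨ (x ∧ y)  ≡⟨ cong (y ∨_) (∧-comm x y) ⟩
    y ∨ (y ∧ x)  ≡⟨ ∨-absorbs-∧ y x ⟩
    y            ∎
    where open ≡-Reasoning

  ≤⇒∧ : ∀ {x y} → x ≤ y → x ∧ y ≡ x
  ≤⇒∧ {x} {y} x≤y = trans (cong (x ∧_) (sym x≤y)) (∧-absorbs-∨ x y)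

  ∨-supremum : Supremum _≤_ _∨_
  ∨-supremum x y = x≤x∨y x y , subst (y ≤_) (∨-comm y x) (x≤x∨y y x) , λ z x≤z y≤z →
    trans (∨-assoc x y z) (trans (cong (x ∨_) y≤z) x≤z)
    where
    x≤x∨y : ∀ u v → u ≤ u ∨ v
    x≤x∨y u v = trans (sym (∨-assoc u u v)) (cong (_∨ v) (∨-idem u))

  ∧-infimum : Infimum _≤_ _∧_
  ∧-infimum x y = x∧y≤x , x∧y≤y , λ z z≤x z≤y →
    ∧⇒≤ (trans (sym (∧-assoc z x y)) (trans (cong (_∧ y) (≤⇒∧ z≤x)) (≤⇒∧ z≤y)))
    where
    x∧y≤x : x ∧ y ≤ x
    x∧y≤x = trans (∨-comm (x ∧ y) x) (∨-absorbs-∧ x y)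
    x∧y≤y : x ∧ y ≤ y
    x∧y≤y = ∧⇒≤ (trans (∧-assoc x y y) (cong (x ∧_) (∧-idem y)))

  lattice : Lattice ℓ ℓ ℓ
  lattice = record
    { _≈_ = _≡_
    ; _≤_ = _≤_
    ; _∨_ = _∨_
    ; _∧_ = _∧_
    ; isLattice = record
      { isPartialOrder = ≤-isPartialOrder
      ; supremum = ∨-supremum
      ; infimum = ∧-infimum
      }
    }

  open Lattice lattice
    using (x≤x∨y; y≤x∨y; ∨-least; x∧y≤x; x∧y≤y; ∧-greatest; joinSemilattice; meetSemilattice)
    renaming (refl to ≤-refl; trans to ≤-trans; antisym to ≤-antisym; reflexive to ≤-reflexive)
  open import Relation.Binary.Lattice.Properties.JoinSemilattice joinSemilattice
    using (∨-monotonic)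
  open import Relation.Binary.Lattice.Properties.MeetSemilattice meetSemilattice
    using (∧-monotonic)

  +-identityʳ : ∀ x → x + 𝟘 ≡ x
  +-identityʳ x = trans (+-comm x 𝟘) (+-identity x)

  +-monoʳ-≤ : ∀ z {x y} → x ≤ y → z + x ≤ z + y
  +-monoʳ-≤ z {x} {y} x≤y = trans (sym (+-distrib-∨ z x y)) (cong (z +_) x≤y)

  +-monoˡ-≤ : ∀ z {x y} → x ≤ y → x + z ≤ y + z
  +-monoˡ-≤ z {x} {y} x≤y = subst₂ _≤_ (+-comm z x) (+-comm z y) (+-monoʳ-≤ z x≤y)

  x≤y⇒y*x+x≡y : ∀ {x y} → x ≤ y → y * x + x ≡ y
  x≤y⇒y*x+x≡y {x} {y} x≤y = begin
    y * x + x        ≡⟨ cong (λ t → y * t + x) (trans (∧-comm y x) (≤⇒∧ x≤y)) ⟨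
    y * (y ∧ x) + x  ≡⟨ ax2 y x ⟩
    y ∨ x            ≡⟨ ∨-comm y x ⟩
    x ∨ y            ≡⟨ x≤y ⟩
    y                ∎
    where open ≡-Reasoning

  𝟘≤x⇒x*𝟘≡x : ∀ {x} → 𝟘 ≤ x → x * 𝟘 ≡ x
  𝟘≤x⇒x*𝟘≡x 𝟘≤x = trans (sym (+-identityʳ _)) (x≤y⇒y*x+x≡y 𝟘≤x)

  -- Translation by x is a contraction, and moves the pair (w, 𝟘) to (y, x).
  w+x≡y⇒y*x≤w : ∀ {w x y} → 𝟘 ≤ w → w + x ≡ y → y * x ≤ w
  w+x≡y⇒y*x≤w {w} {x} 𝟘≤w w+x≡y =
    subst₂ _≤_ (cong₂ _*_ (trans (+-comm x w) w+x≡y) (+-identityʳ x)) (𝟘≤x⇒x*𝟘≡x 𝟘≤w) (+-contr x w 𝟘)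

  x*[x∧y]≡[x∨y]*y : ∀ x y → x * (x ∧ y) ≡ (x ∨ y) * y
  x*[x∧y]≡[x∨y]*y x y = ≤-antisym
    (subst (λ t → t * (x ∧ y) ≤ (x ∨ y) * y) (∧-absorbs-∨ x y) (∧-contr x (x ∨ y) y))
    (w+x≡y⇒y*x≤w (*-nonneg _ _) (ax2 x y))

  y≡[x∨y]*x+[x∧y] : ∀ x y → y ≡ (x ∨ y) * x + (x ∧ y)
  y≡[x∨y]*x+[x∧y] x y = begin
    y                      ≡⟨ x≤y⇒y*x+x≡y (x∧y≤y x y) ⟨
    y * (x ∧ y) + (x ∧ y)  ≡⟨ cong (λ t → y * t + (x ∧ y)) (∧-comm x y) ⟩
    y * (y ∧ x) + (x ∧ y)  ≡⟨ cong (_+ (x ∧ y)) (x*[x∧y]≡[x∨y]*y y x) ⟩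
    (y ∨ x) * x + (x ∧ y)  ≡⟨ cong (λ t → t * x + (x ∧ y)) (∨-comm y x) ⟩
    (x ∨ y) * x + (x ∧ y)  ∎
    where open ≡-Reasoning

  cancellative : Cancellative lattice
  cancellative x y z x∧y≡x∧z x∨y≡x∨z = begin
    y                      ≡⟨ y≡[x∨y]*x+[x∧y] x y ⟩
    (x ∨ y) * x + (x ∧ y)  ≡⟨ cong₂ (λ j m → j * x + m) x∨y≡x∨z x∧y≡x∧z ⟩
    (x ∨ z) * x + (x ∧ z)  ≡⟨ y≡[x∨y]*x+[x∧y] x z ⟨
    z                      ∎
    where open ≡-Reasoning

  open CancellativeLatticeProperties lattice cancellative using (distributiveLattice; ∧-distribˡ-∨)
  open import Relation.Binary.Lattice.Properties.DistributiveLattice distributiveLattice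
    using (∧-distribʳ-∨; ∨-distribˡ-∧)

  betweenM-sym : ∀ {x y z} → BetweenM x y z → BetweenM z y x
  betweenM-sym {x} {y} {z} xyz = begin
    z * y + y * x  ≡⟨ +-comm (z * y) (y * x) ⟩
    y * x + z * y  ≡⟨ cong₂ _+_ (*-comm y x) (*-comm z y) ⟩
    x * y + y * z  ≡⟨ xyz ⟩
    x * z          ≡⟨ *-comm x z ⟩
    z * x          ∎
    where open ≡-Reasoning

  betweenM-xyx⇒≡ : ∀ {x y} → BetweenM x y x → x ≡ y
  betweenM-xyx⇒≡ {x} {y} xyx = Equivalence.to (*-zero⇔ x y) (≤-antisym x*y≤𝟘 (*-nonneg x y))
    where
    open ≤-Reasoning (Lattice.poset lattice)
    x*y≤𝟘 : x * y ≤ 𝟘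
    x*y≤𝟘 = begin
      x * y          ≡⟨ +-identityʳ (x * y) ⟨
      x * y + 𝟘      ≤⟨ +-monoʳ-≤ (x * y) (*-nonneg y x) ⟩
      x * y + y * x  ≡⟨ xyx ⟩
      x * x          ≡⟨ Equivalence.from (*-zero⇔ x x) refl ⟩
      𝟘              ∎

  betweenM-∨ : ∀ x y → BetweenM x (x ∨ y) y
  betweenM-∨ x y = ≤-antisym
    (begin
      x * (x ∨ y) + (x ∨ y) * y  ≡⟨ cong (x * (x ∨ y) +_) (*-comm (x ∨ y) y) ⟩
      x * (x ∨ y) + y * (x ∨ y)  ≡⟨ disjoint⇒+≡∨ (*-nonneg _ _) (ax4 x y) ⟩
      x * (x ∨ y) ∨ y * (x ∨ y)  ≤⟨ ∨-least x*[x∨y]≤x*y y*[x∨y]≤x*y ⟩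
      x * y                      ∎)
    (*-triangle x y (x ∨ y))
    where
    open ≤-Reasoning (Lattice.poset lattice)
    disjoint⇒+≡∨ : ∀ {u v} → 𝟘 ≤ u → u ∧ v ≡ 𝟘 → u + v ≡ u ∨ v
    disjoint⇒+≡∨ {u} {v} 𝟘≤u u∧v≡𝟘 =
      trans (cong (_+ v) (sym (trans (cong (u *_) u∧v≡𝟘) (𝟘≤x⇒x*𝟘≡x 𝟘≤u)))) (ax2 u v)
    x*[x∨y]≤x*y : x * (x ∨ y) ≤ x * y
    x*[x∨y]≤x*y = subst (λ t → t * (x ∨ y) ≤ x * y) (∨-idem x) (∨-contr x x y)
    y*[x∨y]≤x*y : y * (x ∨ y) ≤ x * y
    y*[x∨y]≤x*y = subst₂ (λ s t → s * t ≤ x * y) (∨-idem y) (∨-comm y x)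
      (≤-trans (∨-contr y y x) (≤-reflexive (*-comm y x)))

  betweenM-∧ : ∀ x y → BetweenM x (x ∧ y) y
  betweenM-∧ x y = begin
    x * (x ∧ y) + (x ∧ y) * y  ≡⟨ cong₂ _+_ (x*[x∧y]≡[x∨y]*y x y) [x∧y]*y≡x*[x∨y] ⟩
    (x ∨ y) * y + x * (x ∨ y)  ≡⟨ +-comm _ _ ⟩
    x * (x ∨ y) + (x ∨ y) * y  ≡⟨ betweenM-∨ x y ⟩
    x * y                      ∎
    where
    open ≡-Reasoning
    [x∧y]*y≡x*[x∨y] : (x ∧ y) * y ≡ x * (x ∨ y)
    [x∧y]*y≡x*[x∨y] = begin
      (x ∧ y) * y  ≡⟨ *-comm (x ∧ y) y ⟩
      y * (x ∧ y)  ≡⟨ cong (y *_) (∧-comm x y) ⟩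
      y * (y ∧ x)  ≡⟨ x*[x∧y]≡[x∨y]*y y x ⟩
      (y ∨ x) * x  ≡⟨ cong (_* x) (∨-comm y x) ⟩
      (x ∨ y) * x  ≡⟨ *-comm (x ∨ y) x ⟩
      x * (x ∨ y)  ∎

  x≤y≤z⇒x*y≤x*z : ∀ {x y z} → x ≤ y → y ≤ z → x * y ≤ x * z
  x≤y≤z⇒x*y≤x*z {x} {y} {z} x≤y y≤z =
    subst₂ (λ s t → s * t ≤ x * z) (trans (∧-comm y x) (≤⇒∧ x≤y)) (≤⇒∧ y≤z) (∧-contr y x z)

  -- Translation by x, a contraction, sends z * x and y * x to z and y.
  ≤-≤⇒betweenM : ∀ {x y z} → x ≤ y → y ≤ z → BetweenM x y z
  ≤-≤⇒betweenM {x} {y} {z} x≤y y≤z = betweenM-sym (≤-antisym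
    (begin
      z * y + y * x                ≤⟨ +-monoˡ-≤ (y * x) z*y≤[z*x]*[y*x] ⟩
      (z * x) * (y * x) + y * x    ≡⟨ x≤y⇒y*x+x≡y y*x≤z*x ⟩
      z * x                        ∎)
    (*-triangle z x y))
    where
    open ≤-Reasoning (Lattice.poset lattice)
    x≤z : x ≤ z
    x≤z = ≤-trans x≤y y≤z
    z*y≤[z*x]*[y*x] : z * y ≤ (z * x) * (y * x)
    z*y≤[z*x]*[y*x] = subst₂ (λ s t → s * t ≤ (z * x) * (y * x))
      (trans (+-comm x _) (x≤y⇒y*x+x≡y x≤z)) (trans (+-comm x _) (x≤y⇒y*x+x≡y x≤y))
      (+-contr x (z * x) (y * x))
    y*x≤z*x : y * x ≤ z * x
    y*x≤z*x = subst₂ _≤_ (*-comm x y) (*-comm x z) (x≤y≤z⇒x*y≤x*z x≤y y≤z)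

  betweenL-t1 : ∀ {a b c d} → BetweenL a b c → BetweenL a d b → BetweenL d b c
  betweenL-t1 {a} {b} {c} {d} (a∧c≤b , b≤a∨c) (a∧b≤d , d≤a∨b) = d∧c≤b , b≤d∨c
    where
    open ≤-Reasoning (Lattice.poset lattice)
    d∧c≤b : d ∧ c ≤ b
    d∧c≤b = begin
      d ∧ c                ≤⟨ ∧-monotonic d≤a∨b ≤-refl ⟩
      (a ∨ b) ∧ c          ≡⟨ ∧-distribʳ-∨ c a b ⟩
      (a ∧ c) ∨ (b ∧ c)    ≤⟨ ∨-least a∧c≤b (x∧y≤x b c) ⟩
      b                    ∎
    b≤d∨c : b ≤ d ∨ c
    b≤d∨c = begin
      b                    ≤⟨ ∧-greatest ≤-refl b≤a∨c ⟩
      b ∧ (a ∨ c)          ≡⟨ ∧-distribˡ-∨ b a c ⟩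
      (b ∧ a) ∨ (b ∧ c)    ≤⟨ ∨-monotonic (≤-trans (≤-reflexive (∧-comm b a)) a∧b≤d) (x∧y≤y b c) ⟩
      d ∨ c                ∎

  betweenL⇒[x∨y]∧[y∨z]≡y : ∀ {x y z} → BetweenL x y z → (x ∨ y) ∧ (y ∨ z) ≡ y
  betweenL⇒[x∨y]∧[y∨z]≡y {x} {y} {z} (x∧z≤y , _) = ≤-antisym
    (begin
      (x ∨ y) ∧ (y ∨ z)  ≡⟨ cong (_∧ (y ∨ z)) (∨-comm x y) ⟩
      (y ∨ x) ∧ (y ∨ z)  ≡⟨ ∨-distribˡ-∧ y x z ⟨
      y ∨ (x ∧ z)        ≤⟨ ∨-least ≤-refl x∧z≤y ⟩
      y                  ∎)
    (∧-greatest (y≤x∨y x y) (x≤x∨y y z))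
    where open ≤-Reasoning (Lattice.poset lattice)

  betweenL⇒betweenM : ∀ {a b c} → BetweenL a b c → BetweenM a b c
  betweenL⇒betweenM {a} {b} {c} abc@(_ , b≤a∨c) = begin
    a * b + b * c                          ≡⟨ cong₂ _+_ (betweenM-∨ a b) (betweenM-∨ b c) ⟨
    (a * u + u * b) + (b * v + v * c)      ≡⟨ +-assoc-middle _ _ _ _ ⟩
    a * u + ((u * b + b * v) + v * c)      ≡⟨ cong (λ t → a * u + (t + v * c)) u*b+b*v≡u*j+j*v ⟩
    a * u + ((u * j + j * v) + v * c)      ≡⟨ +-assoc-middle _ _ _ _ ⟨
    (a * u + u * j) + (j * v + v * c)      ≡⟨ cong₂ _+_ (≤-≤⇒betweenM (x≤x∨y a b) u≤j)
                                                          (betweenM-sym (≤-≤⇒betweenM (y≤x∨y b c) v≤j)) ⟩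
    a * j + j * c                          ≡⟨ betweenM-∨ a c ⟩
    a * c                                  ∎
    where
    open ≡-Reasoning
    u v j : A
    u = a ∨ b
    v = b ∨ c
    j = a ∨ c
    u≤j : u ≤ j
    u≤j = ∨-least (x≤x∨y a c) b≤a∨c
    v≤j : v ≤ j
    v≤j = ∨-least b≤a∨c (y≤x∨y a c)
    u∨v≡j : u ∨ v ≡ j
    u∨v≡j = ≤-antisym (∨-least u≤j v≤j) (∨-monotonic (x≤x∨y a b) (y≤x∨y b c))
    +-assoc-middle : ∀ p q r s → (p + q) + (r + s) ≡ p + ((q + r) + s)
    +-assoc-middle p q r s = trans (+-assoc p q (r + s)) (cong (p +_) (sym (+-assoc q r s)))
    u*b+b*v≡u*j+j*v : u * b + b * v ≡ u * j + j * v
    u*b+b*v≡u*j+j*v = begin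
      u * b + b * v                ≡⟨ cong (λ t → u * t + t * v) (betweenL⇒[x∨y]∧[y∨z]≡y abc) ⟨
      u * (u ∧ v) + (u ∧ v) * v    ≡⟨ betweenM-∧ u v ⟩
      u * v                        ≡⟨ betweenM-∨ u v ⟨
      u * (u ∨ v) + (u ∨ v) * v    ≡⟨ cong (λ t → u * t + t * v) u∨v≡j ⟩
      u * j + j * v                ∎

  betweennessEquivalent⇒transitivityT1 : BetweennessEquivalent → TransitivityT1
  betweennessEquivalent⇒transitivityT1 L⇔M a b c d abc adb =
    to (L⇔M d b c) (betweenL-t1 (from (L⇔M a b c) abc) (from (L⇔M a d b) adb))
    where open Equivalence

  module _ (t1 : TransitivityT1) where
    betweenM-shrink : ∀ {a a′ b c c′} →
      BetweenM a b c → BetweenM a a′ b → BetweenM c c′ b → BetweenM a′ b c′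
    betweenM-shrink {a} {a′} {b} {c} {c′} abc aa′b cc′b =
      betweenM-sym (t1 c b a′ c′ (betweenM-sym (t1 a b c a′ abc aa′b)) cc′b)

    betweenM-pinch : ∀ {p q b r} → BetweenM q b p → BetweenM q r b → BetweenM b r p → r ≡ b
    betweenM-pinch {p} {q} {b} {r} qbp qrb brp =
      sym (betweenM-xyx⇒≡ (t1 p r b b (betweenM-sym brp) (betweenM-sym (t1 q b p r qbp qrb))))

    betweenM⇒betweenL : ∀ {a b c} → BetweenM a b c → BetweenL a b c
    betweenM⇒betweenL {a} {b} {c} abc = a∧c≤b , b≤a∨c
      where
      open ≤-Reasoning (Lattice.poset lattice)
      [a∨b]∧[c∨b]≡b : (a ∨ b) ∧ (c ∨ b) ≡ b
      [a∨b]∧[c∨b]≡b = betweenM-pinch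
        (betweenM-shrink abc (betweenM-∨ a b) (betweenM-∨ c b))
        (betweenM-sym (≤-≤⇒betweenM (∧-greatest (y≤x∨y a b) (y≤x∨y c b)) (x∧y≤x _ _)))
        (≤-≤⇒betweenM (∧-greatest (y≤x∨y a b) (y≤x∨y c b)) (x∧y≤y _ _))
      [a∧b]∨[c∧b]≡b : (a ∧ b) ∨ (c ∧ b) ≡ b
      [a∧b]∨[c∧b]≡b = betweenM-pinch
        (betweenM-shrink abc (betweenM-∧ a b) (betweenM-∧ c b))
        (≤-≤⇒betweenM (x≤x∨y _ _) (∨-least (x∧y≤y a b) (x∧y≤y c b)))
        (betweenM-sym (≤-≤⇒betweenM (y≤x∨y _ _) (∨-least (x∧y≤y a b) (x∧y≤y c b))))
      a∧c≤b : a ∧ c ≤ b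
      a∧c≤b = begin
        a ∧ c              ≤⟨ ∧-monotonic (x≤x∨y a b) (x≤x∨y c b) ⟩
        (a ∨ b) ∧ (c ∨ b)  ≡⟨ [a∨b]∧[c∨b]≡b ⟩
        b                  ∎
      b≤a∨c : b ≤ a ∨ c
      b≤a∨c = begin
        b                  ≡⟨ [a∧b]∨[c∧b]≡b ⟨
        (a ∧ b) ∨ (c ∧ b)  ≤⟨ ∨-monotonic (x∧y≤x a b) (x∧y≤x c b) ⟩
        a ∨ c              ∎

    transitivityT1⇒betweennessEquivalent : BetweennessEquivalent
    transitivityT1⇒betweennessEquivalent a b c = mk⇔ betweenL⇒betweenM betweenM⇒betweenL

mainTheorem11 : ∀ {ℓ : Level} (M : ALMonoid ℓ) →
    ALMonoid.BetweennessEquivalent M ⇔ ALMonoid.TransitivityT1 M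
mainTheorem11 M = mk⇔ betweennessEquivalent⇒transitivityT1 transitivityT1⇒betweennessEquivalent
  where open ALMonoidProperties M
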